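{- Let $T$ be a tree on $n$ vertices containing vertices $u_1,\dots,u_8$ such that: $u_1$ is a pendant vertex adjacent to $u_2$; $u_2$ has degree $2$ and is adjacent to $u_1$ and $u_3$; $u_3$ has degree $3$ with neighbors $u_2,u_4,u_5$, where $u_4$ is a pendant vertex; $u_5$ and $u_6$ have degree $2$ and form the path $u_3u_5u_6u_8$; $u_7$ is a pendant vertex adjacent to $u_8$; and all remaining vertices of $T$ (if any) lie in components of $T-\{u_1,\dots,u_7\}$ attached via $u_8$, i.e. $T-\{u_1,\dots,u_7\}$ is connected and contains $u_8$. Let $T_1=T-\{u_1,u_2,u_3,u_4\}$. Then $m_{L(T)}(1)=1+m_{L(T_1)}(1)$.
   Context: $m_{L(G)}(1)$ is the multiplicity of $1$ as an eigenvalue of the Laplacian matrix $L(G)=D(G)-A(G)$. A pendant vertex is a vertex of degree $1$. $T-S$ denotes the subgraph induced on $V(T)\setminus S$. -}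

module Defs where

open import Data.Bool using (Bool; true; false; if_then_else_; _∧_)
open import Data.Nat using (ℕ; zero; suc; _≤_)
open import Data.Fin using (Fin; zero; suc; _≟_)
open import Data.List using (List; []; _∷_; _++_; length)
open import Data.List.Relation.Unary.Unique.Propositional using (Unique)
open import Data.List.Relation.Unary.Linked using (Linked)
open import Data.Product using (Σ; _×_; ∃)
open import Data.Empty using (⊥)
open import Data.Integer using (+_)
open import Data.Rational using (ℚ; 0ℚ; 1ℚ; _+_; _*_; -_)
import Data.Rational as ℚ
open import Relation.Nullary using (¬_; does)
open import Relation.Binary.PropositionalEquality using (_≡_)

record Graph (n : ℕ) : Set where
  field
    adj     : Fin n → Fin n → Bool
    adj-sym : ∀ v w → adj v w ≡ adj w v
    irrefl  : ∀ v → adj v v ≡ false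
open Graph public

VSet : ℕ → Set
VSet n = Fin n → Bool

allV : ∀ {n} → VSet n
allV _ = true

sumℕ : ∀ {n} → (Fin n → ℕ) → ℕ
sumℕ {zero}  f = 0
sumℕ {suc n} f = f zero Data.Nat.+ sumℕ (λ i → f (suc i))

sumℚ : ∀ {n} → (Fin n → ℚ) → ℚ
sumℚ {zero}  f = 0ℚ
sumℚ {suc n} f = f zero + sumℚ (λ i → f (suc i))

adjIn : ∀ {n} → Graph n → VSet n → Fin n → Fin n → Bool
adjIn G K v w = K v ∧ K w ∧ adj G v w

degIn : ∀ {n} → Graph n → VSet n → Fin n → ℕ
degIn G K v = sumℕ (λ w → if adjIn G K v w then 1 else 0)

deg : ∀ {n} → Graph n → Fin n → ℕ
deg G = degIn G allV

Adj : ∀ {n} → Graph n → Fin n → Fin n → Set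
Adj G v w = adj G v w ≡ true

data Walk {n} (G : Graph n) (K : VSet n) : Fin n → Fin n → Set where
  here : ∀ {v} → K v ≡ true → Walk G K v v
  step : ∀ {v x w} → adjIn G K v x ≡ true → Walk G K x w → Walk G K v w

ConnectedIn : ∀ {n} → Graph n → VSet n → Set
ConnectedIn G K = ∀ v w → K v ≡ true → K w ≡ true → Walk G K v w

IsCycle : ∀ {n} → Graph n → List (Fin n) → Set
IsCycle G []       = ⊥
IsCycle G (x ∷ xs) =
  Unique (x ∷ xs) × (3 ≤ length (x ∷ xs)) × Linked (Adj G) ((x ∷ xs) ++ (x ∷ []))

IsTree : ∀ {n} → Graph n → Set
IsTree G = ConnectedIn G allV × (¬ Σ (List _) (IsCycle G))

-- Laplacian L(G[K]) = D - A of the induced subgraph, as a matrix over ℚ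
-- indexed by K × K (we index by Fin n and only use entries with both indices in K).
laplacianIn : ∀ {n} → Graph n → VSet n → Fin n → Fin n → ℚ
laplacianIn G K v w with does (v ≟ w)
... | true  = (+ degIn G K v) ℚ./ 1
... | false = if adjIn G K v w then - 1ℚ else 0ℚ

-- x : ℚ^{K} (represented as a vector on Fin n vanishing off K) is an eigenvector
-- (or zero) of L(G[K]) for eigenvalue 1, i.e. L(G[K]) x = 1 · x.
InEigenspace1 : ∀ {n} → Graph n → VSet n → (Fin n → ℚ) → Set
InEigenspace1 G K x =
  (∀ v → K v ≡ false → x v ≡ 0ℚ) ×
  (∀ v → K v ≡ true →
     sumℚ (λ w → if K w then laplacianIn G K v w * x w else 0ℚ) ≡ x v)

LinIndep : ∀ {n k} → (Fin k → Fin n → ℚ) → Set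
LinIndep {n} {k} xs =
  ∀ (c : Fin k → ℚ) → (∀ v → sumℚ (λ i → c i * xs i v) ≡ 0ℚ) → ∀ i → c i ≡ 0ℚ

-- m_{L(G[K])}(1) = m : the 1-eigenspace of L(G[K]) has dimension exactly m
-- (L is symmetric, so algebraic = geometric multiplicity; L has integer entries,
-- so the dimension over ℚ equals the dimension over ℝ).
MultLaplacian1 : ∀ {n} → Graph n → VSet n → ℕ → Set
MultLaplacian1 {n} G K m =
  (Σ (Fin m → Fin n → ℚ) λ xs → (∀ i → InEigenspace1 G K (xs i)) × LinIndep xs) ×
  (∀ (xs : Fin (suc m) → Fin n → ℚ) → (∀ i → InEigenspace1 G K (xs i)) → ¬ LinIndep xs)

minus : ∀ {n} → List (Fin n) → VSet n
minus []       v = true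
minus (s ∷ ss) v = if does (v ≟ s) then false else minus ss v

-- A 1-eigenvector x of L(T) vanishes at the neighbour of every pendant vertex. Along the
-- branch u₁u₂u₃u₄ this gives x(u₂) = x(u₃) = 0, then x(u₁) = 0 and x(u₄) = −x(u₅). So if
-- x(u₅) = 0, x is supported on T₁; as u₃u₅ is the only edge leaving T₁ and x vanishes at both
-- ends, x is then a 1-eigenvector of L(T₁). Conversely, in T₁ the pendant vertices u₇ and u₅
-- force y(u₈) = y(u₆) = 0 and then y(u₅) = 0, so extending by zero embeds the 1-eigenspace
-- of L(T₁) into the hyperplane x(u₅) = 0 of that of L(T). The vector z = −e₄ + e₅ + e₆ − e₇
-- is a 1-eigenvector of L(T) with z(u₄) ≠ 0: a vertex outside its support is adjacent to u₄
-- iff to u₅ (iff it is u₃) and to u₇ iff to u₆ (iff it is u₈), so the ±1 values cancel in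
-- its neighbour sum. Hence the multiplicity goes up by exactly one; with multiplicities given
-- as sizes of maximal independent families, adjoining z proves one inequality and one step
-- of Gaussian elimination at u₅ the other.

module Submission where

open import Defs
open import Algebra.Bundles using (CommutativeMonoid)
import Algebra.Properties.CommutativeMonoid.Sum as CommutativeMonoidSum
open import Data.Bool using (true; false; if_then_else_; _∧_)
open import Data.Empty using (⊥-elim)
open import Data.Fin using (Fin; zero; suc; _≟_; punchIn)
open import Data.Fin.Patterns using (0F; 1F; 2F; 3F; 4F; 5F; 6F; 7F)
open import Data.Fin.Properties using (punchInᵢ≢i; all?; ¬∀⟶∃¬)
import Data.Integer as ℤ
open import Data.List using (List; []; _∷_; _++_; length; foldr; lookup)
open import Data.List.Membership.Propositional using (_∈_; _∉_)
open import Data.List.Membership.Propositional.Properties using (∈-++⁻; ∈-lookup)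
open import Data.List.Relation.Unary.All as All using (All; []; _∷_)
open import Data.List.Relation.Unary.All.Properties using (All¬⇒¬Any; ¬Any⇒All¬; ++⁻ʳ)
open import Data.List.Relation.Unary.AllPairs using ([]; _∷_)
open import Data.List.Relation.Unary.Any as Any using (here; there)
open import Data.List.Relation.Unary.Unique.Propositional using (Unique)
open import Data.Nat as ℕ using (ℕ; suc; _≤_; _≤′_; ≤′-refl; ≤′-step)
open import Data.Nat.Properties using (≤-antisym; ≮⇒≥; ≤⇒≤′; <-irrefl; +-0-commutativeMonoid; +-monoʳ-≤)
import Data.Nat.Properties as ℕₚ
open import Data.Product using (Σ; _×_; _,_; proj₁; proj₂; uncurry)
open import Data.Rational using (ℚ; 0ℚ; 1ℚ; _+_; _*_; -_; _-_; _/_; 1/_; ≢-nonZero)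
open import Data.Rational.Properties
  using (+-identityˡ; +-identityʳ; +-inverseʳ; *-zeroˡ; *-zeroʳ; *-identityʳ; *-assoc; *-comm;
         *-inverseʳ; *-distribˡ-+; neg-distrib-+; neg-distribˡ-*; *-identityˡ)
  renaming (_≟_ to _≟ℚ_; +-0-commutativeMonoid to ℚ-+-0-commutativeMonoid)
open import Data.Rational.Solver using (module +-*-Solver)
open import Data.Sum using (_⊎_; inj₁; inj₂; [_,_]; [_,_]′)
open import Data.Vec.Functional as Vector using (tail; removeAt; insertAt; updateAt)
open import Data.Vec.Functional.Properties using (updateAt-updates; updateAt-minimal; insertAt-lookup; insertAt-punchIn)
open import Function using (_∘_; const)
open import Relation.Nullary using (¬_; does; yes; no; contradiction)
open import Relation.Nullary.Decidable using (False; toWitnessFalse; dec-true; dec-false)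
open import Relation.Binary.PropositionalEquality
  using (_≡_; _≢_; refl; sym; trans; cong; cong₂; ≢-sym; module ≡-Reasoning)

open +-*-Solver using (solve; _:+_; _:*_; _:-_; :-_; _:=_; con)

lookup-injective : ∀ {a} {A : Set a} {xs : List A} → Unique xs →
                   ∀ {i j} → lookup xs i ≡ lookup xs j → i ≡ j
lookup-injective (_  ∷ _) {zero}  {zero}  _ = refl
lookup-injective (x∉ ∷ _) {zero}  {suc j} e = ⊥-elim (All.lookup x∉ (∈-lookup j) e)
lookup-injective (x∉ ∷ _) {suc i} {zero}  e = ⊥-elim (All.lookup x∉ (∈-lookup i) (sym e))
lookup-injective (_  ∷ u) {suc i} {suc j} e = cong suc (lookup-injective u e)

unique-++⁻ʳ : ∀ {a} {A : Set a} (xs : List A) {ys} → Unique (xs ++ ys) → Unique ys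
unique-++⁻ʳ []       u       = u
unique-++⁻ʳ (_ ∷ xs) (_ ∷ u) = unique-++⁻ʳ xs u

-- sumℕ and sumℚ are separate recursive definitions, equal to the library's sum only
-- propositionally, so these lemmas are stated for any ∑ that agrees with it.
module FinSum {c ℓ} (M : CommutativeMonoid c ℓ)
  (∑ : ∀ {n} → (Fin n → CommutativeMonoid.Carrier M) → CommutativeMonoid.Carrier M)
  (∑≈sum : ∀ {n} (f : Fin n → CommutativeMonoid.Carrier M) →
           CommutativeMonoid._≈_ M (∑ f) (CommutativeMonoidSum.sum M f)) where

  open CommutativeMonoid M
    using (_≈_; setoid)
    renaming (Carrier to A; _∙_ to _+ₘ_; ε to 0#; ∙-cong to +-cong; ∙-congˡ to +-congˡ;
              identityˡ to +ₘ-identityˡ; refl to ≈-refl; sym to ≈-sym; trans to ≈-trans;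
              reflexive to ≈-reflexive)
  open CommutativeMonoidSum M using (sum-remove; sum-cong-≋; sum-replicate-zero; ∑-distrib-+)
  open import Relation.Binary.Reasoning.Setoid setoid

  ∑-cong : ∀ {n} {f g : Fin n → A} → (∀ w → f w ≈ g w) → ∑ f ≈ ∑ g
  ∑-cong {f = f} {g} f≈g = ≈-trans (∑≈sum f) (≈-trans (sum-cong-≋ f≈g) (≈-sym (∑≈sum g)))

  ∑-zero : ∀ {n} {f : Fin n → A} → (∀ w → f w ≈ 0#) → ∑ f ≈ 0#
  ∑-zero {n} {f} f≈0 = ≈-trans (∑≈sum f) (≈-trans (sum-cong-≋ f≈0) (sum-replicate-zero n))

  ∑-+ : ∀ {n} (f g : Fin n → A) → ∑ (λ w → f w +ₘ g w) ≈ ∑ f +ₘ ∑ g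
  ∑-+ f g = ≈-trans (∑≈sum _) (≈-trans (∑-distrib-+ f g) (≈-sym (+-cong (∑≈sum f) (∑≈sum g))))

  ∑-remove : ∀ {n} (i : Fin (suc n)) (f : Fin (suc n) → A) → ∑ f ≈ f i +ₘ ∑ (removeAt f i)
  ∑-remove i f = ≈-trans (∑≈sum f) (≈-trans (sum-remove f) (+-congˡ (≈-sym (∑≈sum _))))

  ∑-extract : ∀ {n} (f : Fin n → A) q → ∑ f ≈ f q +ₘ ∑ (updateAt f q (const 0#))
  ∑-extract {suc n} f q = begin
    ∑ f                     ≈⟨ ∑-remove q f ⟩
    f q +ₘ ∑ (removeAt f q) ≈⟨ +-congˡ (≈-sym rest) ⟩
    f q +ₘ ∑ f₀             ∎
    where
    f₀ : Fin _ → A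
    f₀ = updateAt f q (const 0#)
    rest : ∑ f₀ ≈ ∑ (removeAt f q)
    rest = begin
      ∑ f₀                      ≈⟨ ∑-remove q f₀ ⟩
      f₀ q +ₘ ∑ (removeAt f₀ q) ≈⟨ +-cong (≈-reflexive (updateAt-updates q f)) (∑-cong unchanged) ⟩
      0# +ₘ ∑ (removeAt f q)    ≈⟨ +ₘ-identityˡ _ ⟩
      ∑ (removeAt f q)          ∎
      where
      unchanged : ∀ j → f₀ (punchIn q j) ≈ f (punchIn q j)
      unchanged j = ≈-reflexive (updateAt-minimal (punchIn q j) q f (punchInᵢ≢i q j))

  sumOver : ∀ {n} → List (Fin n) → (Fin n → A) → A
  sumOver ps f = foldr (λ p s → f p +ₘ s) 0# ps

  sumOver-cong : ∀ {n} (ps : List (Fin n)) {f g} → (∀ {w} → w ∈ ps → f w ≈ g w) →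
                 sumOver ps f ≈ sumOver ps g
  sumOver-cong []       f≈g = ≈-refl
  sumOver-cong (p ∷ ps) f≈g = +-cong (f≈g (here refl)) (sumOver-cong ps (f≈g ∘ there))

  sumOver-zero : ∀ {n} {ps : List (Fin n)} {f} → All (λ w → f w ≈ 0#) ps → sumOver ps f ≈ 0#
  sumOver-zero []           = ≈-refl
  sumOver-zero (fp≈0 ∷ f≈0) = ≈-trans (+-cong fp≈0 (sumOver-zero f≈0)) (+ₘ-identityˡ 0#)

  ∑-support : ∀ {n} {qs : List (Fin n)} {f} → Unique qs → (∀ {w} → w ∉ qs → f w ≈ 0#) →
              ∑ f ≈ sumOver qs f
  ∑-support {qs = []}     _ off = ∑-zero (λ w → off λ ())
  ∑-support {qs = q ∷ qs} {f} (q∉qs ∷ uqs) off = begin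
    ∑ f                  ≈⟨ ∑-extract f q ⟩
    f q +ₘ ∑ f₀          ≈⟨ +-congˡ (∑-support uqs off₀) ⟩
    f q +ₘ sumOver qs f₀ ≈⟨ +-congˡ (sumOver-cong qs unchanged) ⟩
    f q +ₘ sumOver qs f  ∎
    where
    f₀ : Fin _ → A
    f₀ = updateAt f q (const 0#)
    unchanged : ∀ {w} → w ∈ qs → f₀ w ≈ f w
    unchanged w∈qs = ≈-reflexive (updateAt-minimal _ q f (≢-sym (All.lookup q∉qs w∈qs)))
    off₀ : ∀ {w} → w ∉ qs → f₀ w ≈ 0#
    off₀ {w} w∉qs with w ≟ q
    ... | yes refl = ≈-reflexive (updateAt-updates q f)
    ... | no w≢q   = ≈-trans (≈-reflexive (updateAt-minimal w q f w≢q))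
                             (off λ { (here w≡q) → w≢q w≡q ; (there w∈qs) → w∉qs w∈qs })

sumℕ≡sum : ∀ {n} (f : Fin n → ℕ) → sumℕ f ≡ CommutativeMonoidSum.sum +-0-commutativeMonoid f
sumℕ≡sum {ℕ.zero} f = refl
sumℕ≡sum {suc n}  f = cong (f zero ℕ.+_) (sumℕ≡sum (f ∘ suc))

sumℚ≡sum : ∀ {n} (f : Fin n → ℚ) → sumℚ f ≡ CommutativeMonoidSum.sum ℚ-+-0-commutativeMonoid f
sumℚ≡sum {ℕ.zero} f = refl
sumℚ≡sum {suc n}  f = cong (f zero +_) (sumℚ≡sum (f ∘ suc))

module ℕ∑ = FinSum +-0-commutativeMonoid sumℕ sumℕ≡sum
open FinSum ℚ-+-0-commutativeMonoid sumℚ sumℚ≡sum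

sumOver≤sumℕ : ∀ {n} {qs : List (Fin n)} → Unique qs → ∀ f → ℕ∑.sumOver qs f ≤ sumℕ f
sumOver≤sumℕ {qs = []}     _            f = ℕ.z≤n
sumOver≤sumℕ {qs = q ∷ qs} (q∉qs ∷ uqs) f = begin
  f q ℕ.+ ℕ∑.sumOver qs f   ≡⟨ cong (f q ℕ.+_) (ℕ∑.sumOver-cong qs unchanged) ⟩
  f q ℕ.+ ℕ∑.sumOver qs f₀  ≤⟨ +-monoʳ-≤ (f q) (sumOver≤sumℕ uqs f₀) ⟩
  f q ℕ.+ sumℕ f₀           ≡⟨ sym (ℕ∑.∑-extract f q) ⟩
  sumℕ f                    ∎
  where
  open ℕₚ.≤-Reasoning
  f₀ : Fin _ → ℕ
  f₀ = updateAt f q (const 0)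
  unchanged : ∀ {w} → w ∈ qs → f w ≡ f₀ w
  unchanged w∈qs = sym (updateAt-minimal _ q f (≢-sym (All.lookup q∉qs w∈qs)))

∑-neg : ∀ {n} (f : Fin n → ℚ) → sumℚ (λ w → - f w) ≡ - sumℚ f
∑-neg {ℕ.zero} f = refl
∑-neg {suc n}  f = trans (cong (- f zero +_) (∑-neg (f ∘ suc))) (sym (neg-distrib-+ (f zero) (sumℚ (f ∘ suc))))

∑-*ˡ : ∀ {n} t (f : Fin n → ℚ) → sumℚ (λ w → t * f w) ≡ t * sumℚ f
∑-*ˡ {ℕ.zero} t f = sym (*-zeroʳ t)
∑-*ˡ {suc n}  t f = trans (cong (t * f zero +_) (∑-*ˡ t (f ∘ suc))) (sym (*-distribˡ-+ t _ _))

∑-*ʳ : ∀ {n} (f : Fin n → ℚ) t → sumℚ (λ w → f w * t) ≡ sumℚ f * t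
∑-*ʳ f t = trans (∑-cong (λ w → *-comm (f w) t)) (trans (∑-*ˡ t f) (*-comm t _))

∑-sub : ∀ {n} (f g : Fin n → ℚ) → sumℚ (λ w → f w - g w) ≡ sumℚ f - sumℚ g
∑-sub f g = trans (∑-+ f (λ w → - g w)) (cong (sumℚ f +_) (∑-neg g))

p*q≡0⇒p≡0 : ∀ {p q} → q ≢ 0ℚ → p * q ≡ 0ℚ → p ≡ 0ℚ
p*q≡0⇒p≡0 {p} {q} q≢0 pq≡0 = begin
  p              ≡⟨ sym (*-identityʳ p) ⟩
  p * 1ℚ         ≡⟨ cong (p *_) (sym (*-inverseʳ q)) ⟩
  p * (q * 1/ q) ≡⟨ sym (*-assoc p q (1/ q)) ⟩
  p * q * 1/ q   ≡⟨ cong (_* 1/ q) pq≡0 ⟩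
  0ℚ * 1/ q      ≡⟨ *-zeroˡ (1/ q) ⟩
  0ℚ             ∎
  where
  open ≡-Reasoning
  instance _ = ≢-nonZero q≢0

fromℕ : ℕ → ℚ
fromℕ k = (ℤ.+ k) / 1

Adj-sym : ∀ {n} (G : Graph n) {v w} → Adj G v w → Adj G w v
Adj-sym G {v} {w} vw = trans (adj-sym G w v) vw

neighbourSumIn : ∀ {n} → Graph n → VSet n → (Fin n → ℚ) → Fin n → ℚ
neighbourSumIn G K x v = sumℚ (λ w → if adjIn G K v w then x w else 0ℚ)

applyLaplacianIn : ∀ {n} → Graph n → VSet n → (Fin n → ℚ) → Fin n → ℚ
applyLaplacianIn G K x v = sumℚ (λ w → if K w then laplacianIn G K v w * x w else 0ℚ)

laplacianIn-diagonal : ∀ {n} (G : Graph n) K v → laplacianIn G K v v ≡ fromℕ (degIn G K v)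
laplacianIn-diagonal G K v with v ≟ v
... | yes _   = refl
... | no v≢v = ⊥-elim (v≢v refl)

laplacianIn-offDiagonal : ∀ {n} (G : Graph n) K {v w} → v ≢ w →
                          laplacianIn G K v w ≡ (if adjIn G K v w then - 1ℚ else 0ℚ)
laplacianIn-offDiagonal G K {v} {w} v≢w with v ≟ w
... | yes v≡w = ⊥-elim (v≢w v≡w)
... | no _    = refl

applyLaplacianIn-row : ∀ {n} (G : Graph n) K x {v} → K v ≡ true →
                       applyLaplacianIn G K x v ≡ fromℕ (degIn G K v) * x v - neighbourSumIn G K x v
applyLaplacianIn-row G K x {v} v∈K = begin
  sumℚ t                               ≡⟨ ∑-extract t v ⟩
  t v + sumℚ (updateAt t v (const 0ℚ)) ≡⟨ cong₂ _+_ diagonal (trans (∑-cong offDiagonal) (∑-neg a)) ⟩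
  fromℕ (degIn G K v) * x v - sumℚ a   ∎
  where
  open ≡-Reasoning
  t a : Fin _ → ℚ
  t w = if K w then laplacianIn G K v w * x w else 0ℚ
  a w = if adjIn G K v w then x w else 0ℚ
  diagonal : t v ≡ fromℕ (degIn G K v) * x v
  diagonal = trans (cong (λ b → if b then laplacianIn G K v v * x v else 0ℚ) v∈K)
                   (cong (_* x v) (laplacianIn-diagonal G K v))
  entry : ∀ w → v ≢ w → t w ≡ - a w
  entry w v≢w rewrite laplacianIn-offDiagonal G K v≢w | v∈K with K w
  ... | false = refl
  ... | true with adj G v w
  ...   | true  = trans (sym (neg-distribˡ-* 1ℚ (x w))) (cong -_ (*-identityˡ (x w)))
  ...   | false = *-zeroˡ (x w)
  offDiagonal : ∀ w → updateAt t v (const 0ℚ) w ≡ - a w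
  offDiagonal w with w ≟ v
  ... | yes refl rewrite v∈K | irrefl G v = updateAt-updates v t
  ... | no w≢v   = trans (updateAt-minimal w v t w≢v) (entry w (≢-sym w≢v))

record Neighbourhood {n} (G : Graph n) (K : VSet n) (v : Fin n) (ps : List (Fin n)) : Set where
  field
    unique   : Unique ps
    adjacent : All (λ w → adjIn G K v w ≡ true) ps
    complete : ∀ {w} → w ∉ ps → adjIn G K v w ≡ false
open Neighbourhood

count-adjacent : ∀ {n} {G : Graph n} {K v} {ps : List (Fin n)} → All (λ w → adjIn G K v w ≡ true) ps →
                 ℕ∑.sumOver ps (λ w → if adjIn G K v w then 1 else 0) ≡ length ps
count-adjacent                 []                    = refl
count-adjacent {G = G} {K} {v} (vp ∷ vps) rewrite vp = cong suc (count-adjacent {G = G} {K} {v} vps)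

neighbourhood-from-degree : ∀ {n} {G : Graph n} {v} {ps : List (Fin n)} →
  Unique ps → All (Adj G v) ps → deg G v ≡ length ps → Neighbourhood G allV v ps
neighbourhood-from-degree {G = G} {v} {ps} uniq vps deg≡ =
  record { unique = uniq ; adjacent = vps ; complete = no-other-neighbour }
  where
  indicator : Fin _ → ℕ
  indicator w = if adj G v w then 1 else 0
  no-other-neighbour : ∀ {w} → w ∉ ps → adj G v w ≡ false
  no-other-neighbour {w} w∉ps with adj G v w in vw
  ... | false = refl
  ... | true  = ⊥-elim (<-irrefl refl (begin
    suc (length ps)                ≡⟨ sym (count-adjacent {G = G} {allV} (vw ∷ vps)) ⟩
    ℕ∑.sumOver (w ∷ ps) indicator  ≤⟨ sumOver≤sumℕ (¬Any⇒All¬ ps w∉ps ∷ uniq) indicator ⟩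
    sumℕ indicator                 ≡⟨ deg≡ ⟩
    length ps                      ∎))
    where open ℕₚ.≤-Reasoning

degIn-neighbourhood : ∀ {n} {G : Graph n} {K v ps} → Neighbourhood G K v ps → degIn G K v ≡ length ps
degIn-neighbourhood {G = G} {K} {v} N =
  trans (ℕ∑.∑-support (unique N) (λ w∉ps → cong (λ b → if b then 1 else 0) (complete N w∉ps)))
        (count-adjacent {G = G} {K} {v} (adjacent N))

neighbourSumIn-neighbourhood : ∀ {n} {G : Graph n} {K v ps} → Neighbourhood G K v ps →
                               ∀ x → neighbourSumIn G K x v ≡ sumOver ps x
neighbourSumIn-neighbourhood {ps = ps} N x =
  trans (∑-support (unique N) (λ {w} w∉ps → cong (λ b → if b then x w else 0ℚ) (complete N w∉ps)))
        (sumOver-cong ps (λ {w} w∈ps → cong (λ b → if b then x w else 0ℚ) (All.lookup (adjacent N) w∈ps)))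

applyLaplacianIn-neighbourhood : ∀ {n} {G : Graph n} {K v ps} → Neighbourhood G K v ps → K v ≡ true →
  ∀ x → applyLaplacianIn G K x v ≡ fromℕ (length ps) * x v - sumOver ps x
applyLaplacianIn-neighbourhood {G = G} {K} {v} N v∈K x =
  trans (applyLaplacianIn-row G K x v∈K)
        (cong₂ (λ d s → fromℕ d * x v - s) (degIn-neighbourhood N) (neighbourSumIn-neighbourhood N x))

neighbourhood-restrict : ∀ {n} {G : Graph n} {K v} ds {ps : List (Fin n)} →
  Neighbourhood G allV v (ds ++ ps) → K v ≡ true →
  All (λ d → K d ≡ false) ds → All (λ p → K p ≡ true) ps → Neighbourhood G K v ps
neighbourhood-restrict {G = G} {K} {v} ds {ps} N v∈K ds∉K ps∈K = record
  { unique   = unique-++⁻ʳ ds (unique N)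
  ; adjacent = All.zipWith (uncurry adjacentIn) (ps∈K , ++⁻ʳ ds (adjacent N))
  ; complete = completeIn
  }
  where
  adjacentIn : ∀ {p} → K p ≡ true → adj G v p ≡ true → K v ∧ K p ∧ adj G v p ≡ true
  adjacentIn p∈K vp rewrite v∈K | p∈K | vp = refl
  completeIn : ∀ {w} → w ∉ ps → K v ∧ K w ∧ adj G v w ≡ false
  completeIn {w} w∉ps with K w in Kw
  ... | false rewrite v∈K = refl
  ... | true  rewrite v∈K = complete N ([ w∉ds , w∉ps ] ∘ ∈-++⁻ ds)
    where
    w∉ds : w ∉ ds
    w∉ds w∈ds with trans (sym Kw) (All.lookup ds∉K w∈ds)
    ... | ()

∈-neighbourhood : ∀ {n} {G : Graph n} {v w} {ps : List (Fin n)} →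
                  Neighbourhood G allV v ps → Adj G v w → w ∈ ps
∈-neighbourhood {w = w} {ps} N vw with Any.any? (w ≟_) ps
... | yes w∈ps = w∈ps
... | no w∉ps with trans (sym vw) (complete N w∉ps)
...   | ()

non-neighbour : ∀ {n} {G : Graph n} {u v} {ps : List (Fin n)} →
                Neighbourhood G allV u ps → v ∉ ps → adj G v u ≡ false
non-neighbour {G = G} {u} {v} N v∉ps = trans (adj-sym G v u) (complete N v∉ps)

degIn≡deg : ∀ {n} (G : Graph n) K {v} → K v ≡ true → (∀ {w} → K w ≡ false → ¬ Adj G v w) →
            degIn G K v ≡ deg G v
degIn≡deg G K {v} v∈K cut = ℕ∑.∑-cong entry
  where
  entry : ∀ w → (if K v ∧ K w ∧ adj G v w then 1 else 0) ≡ (if adj G v w then 1 else 0)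
  entry w rewrite v∈K with K w in Kw
  ... | true  = refl
  ... | false with adj G v w in vw
  ...   | true  = ⊥-elim (cut Kw vw)
  ...   | false = refl

applyLaplacianIn-agree : ∀ {n} (G : Graph n) K {x v} → K v ≡ true → (∀ w → K w ≡ false → x w ≡ 0ℚ) →
  x v ≡ 0ℚ ⊎ degIn G K v ≡ deg G v → applyLaplacianIn G K x v ≡ applyLaplacianIn G allV x v
applyLaplacianIn-agree G K {x} {v} v∈K x-off diagonal = begin
  applyLaplacianIn G K x v
    ≡⟨ applyLaplacianIn-row G K x v∈K ⟩
  fromℕ (degIn G K v) * x v - neighbourSumIn G K x v
    ≡⟨ cong₂ _-_ (same-diagonal diagonal) (∑-cong same-neighbours) ⟩
  fromℕ (deg G v) * x v - neighbourSumIn G allV x v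
    ≡⟨ sym (applyLaplacianIn-row G allV x refl) ⟩
  applyLaplacianIn G allV x v
    ∎
  where
  open ≡-Reasoning
  same-diagonal : x v ≡ 0ℚ ⊎ degIn G K v ≡ deg G v →
                  fromℕ (degIn G K v) * x v ≡ fromℕ (deg G v) * x v
  same-diagonal (inj₁ xv≡0) rewrite xv≡0 =
    trans (*-zeroʳ (fromℕ (degIn G K v))) (sym (*-zeroʳ (fromℕ (deg G v))))
  same-diagonal (inj₂ deg≡) rewrite deg≡ = refl
  same-neighbours : ∀ w → (if K v ∧ K w ∧ adj G v w then x w else 0ℚ) ≡ (if adj G v w then x w else 0ℚ)
  same-neighbours w rewrite v∈K with K w in Kw
  ... | true  = refl
  ... | false rewrite x-off w Kw with adj G v w
  ...   | true  = refl
  ...   | false = refl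

applyLaplacianIn-null : ∀ {n} (G : Graph n) K {x v} → K v ≡ true → x v ≡ 0ℚ →
                        neighbourSumIn G K x v ≡ 0ℚ → applyLaplacianIn G K x v ≡ 0ℚ
applyLaplacianIn-null G K {x} {v} v∈K xv≡0 nbr≡0 =
  trans (applyLaplacianIn-row G K x v∈K)
        (trans (cong₂ (λ a s → d * a - s) xv≡0 nbr≡0) (cong (_- 0ℚ) (*-zeroʳ d)))
  where
  d : ℚ
  d = fromℕ (degIn G K v)

neighbourSumIn-null : ∀ {n} (G : Graph n) {x v} → (∀ {w} → Adj G v w → x w ≡ 0ℚ) →
                      neighbourSumIn G allV x v ≡ 0ℚ
neighbourSumIn-null G {x} {v} nbr≡0 = ∑-zero entry
  where
  entry : ∀ w → (if adj G v w then x w else 0ℚ) ≡ 0ℚ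
  entry w with adj G v w in vw
  ... | true  = nbr≡0 vw
  ... | false = refl

module _ {n} {G : Graph n} {K} {x} (E : InEigenspace1 G K x) {v} (v∈K : K v ≡ true) where

  eigen-row : ∀ {ps} → Neighbourhood G K v ps → fromℕ (length ps) * x v - sumOver ps x ≡ x v
  eigen-row N = trans (sym (applyLaplacianIn-neighbourhood N v∈K x)) (proj₂ E v v∈K)

  eigen-neighbour : ∀ {p ps} → Neighbourhood G K v (p ∷ ps) →
                    x p ≡ fromℕ (length (p ∷ ps)) * x v - x v - sumOver ps x
  eigen-neighbour {p} {ps} N = begin
    x p
      ≡⟨ solve 4 (λ d a b s → b := d :* a :- (d :* a :- (b :+ s)) :- s) refl d (x v) (x p) S ⟩
    d * x v - (d * x v - (x p + S)) - S
      ≡⟨ cong (λ r → d * x v - r - S) (eigen-row N) ⟩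
    d * x v - x v - S
      ∎
    where
    open ≡-Reasoning
    d : ℚ
    d = fromℕ (length (p ∷ ps))
    S : ℚ
    S = sumOver ps x

  eigen-pendant : ∀ {p} → Neighbourhood G K v (p ∷ []) → x p ≡ 0ℚ
  eigen-pendant {p} N = begin
    x p                   ≡⟨ eigen-neighbour N ⟩
    1ℚ * x v - x v - 0ℚ   ≡⟨ cong (λ a → a - x v - 0ℚ) (*-identityˡ (x v)) ⟩
    x v - x v - 0ℚ        ≡⟨ cong (_- 0ℚ) (+-inverseʳ (x v)) ⟩
    0ℚ                    ∎
    where open ≡-Reasoning

  eigen-neighbour-zero : ∀ {p ps} → Neighbourhood G K v (p ∷ ps) →
                         x v ≡ 0ℚ → All (λ w → x w ≡ 0ℚ) ps → x p ≡ 0ℚ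
  eigen-neighbour-zero {p} {ps} N xv≡0 xps≡0 = begin
    x p                          ≡⟨ eigen-neighbour N ⟩
    d * x v - x v - sumOver ps x ≡⟨ cong₂ (λ a s → d * a - a - s) xv≡0 (sumOver-zero xps≡0) ⟩
    d * 0ℚ - 0ℚ - 0ℚ             ≡⟨ cong (λ a → a - 0ℚ - 0ℚ) (*-zeroʳ d) ⟩
    0ℚ                           ∎
    where
    open ≡-Reasoning
    d : ℚ
    d = fromℕ (length (p ∷ ps))

ClosedUnderCombinations : ∀ {n} → ((Fin n → ℚ) → Set) → Set
ClosedUnderCombinations P = ∀ s t {x y} → P x → P y → P (λ w → s * x w - t * y w)

inEigenspace1-closed : ∀ {n} (G : Graph n) K → ClosedUnderCombinations (InEigenspace1 G K)
inEigenspace1-closed G K s t {x} {y} (x-off , x-row) (y-off , y-row) = off , row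
  where
  off : ∀ v → K v ≡ false → s * x v - t * y v ≡ 0ℚ
  off v v∉K rewrite x-off v v∉K | y-off v v∉K = cong₂ _-_ (*-zeroʳ s) (*-zeroʳ t)
  row : ∀ v → K v ≡ true → applyLaplacianIn G K (λ w → s * x w - t * y w) v ≡ s * x v - t * y v
  row v v∈K = begin
    sumℚ (λ w → if K w then laplacianIn G K v w * (s * x w - t * y w) else 0ℚ)
      ≡⟨ ∑-cong entry ⟩
    sumℚ (λ w → s * Lx w - t * Ly w)
      ≡⟨ ∑-sub (λ w → s * Lx w) (λ w → t * Ly w) ⟩
    sumℚ (λ w → s * Lx w) - sumℚ (λ w → t * Ly w)
      ≡⟨ cong₂ _-_ (∑-*ˡ s Lx) (∑-*ˡ t Ly) ⟩
    s * applyLaplacianIn G K x v - t * applyLaplacianIn G K y v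
      ≡⟨ cong₂ (λ a b → s * a - t * b) (x-row v v∈K) (y-row v v∈K) ⟩
    s * x v - t * y v
      ∎
    where
    open ≡-Reasoning
    Lx Ly : Fin _ → ℚ
    Lx w = if K w then laplacianIn G K v w * x w else 0ℚ
    Ly w = if K w then laplacianIn G K v w * y w else 0ℚ
    entry : ∀ w → (if K w then laplacianIn G K v w * (s * x w - t * y w) else 0ℚ) ≡ s * Lx w - t * Ly w
    entry w with K w
    ... | true  = solve 5 (λ l s t a b → l :* (s :* a :- t :* b) := s :* (l :* a) :- t :* (l :* b))
                          refl (laplacianIn G K v w) s t (x w) (y w)
    ... | false = solve 2 (λ s t → con 0ℚ := s :* con 0ℚ :- t :* con 0ℚ) refl s t

IndependentIn : ∀ {n} → ((Fin n → ℚ) → Set) → ℕ → Set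
IndependentIn {n} P k = Σ (Fin k → Fin n → ℚ) λ xs → (∀ i → P (xs i)) × LinIndep xs

-- MultLaplacian1 G K m unfolds to HasDimension (InEigenspace1 G K) m.
HasDimension : ∀ {n} → ((Fin n → ℚ) → Set) → ℕ → Set
HasDimension {n} P m =
  IndependentIn P m × (∀ (xs : Fin (suc m) → Fin n → ℚ) → (∀ i → P (xs i)) → ¬ LinIndep xs)

linIndep-tail : ∀ {n k} {xs : Fin (suc k) → Fin n → ℚ} → LinIndep xs → LinIndep (tail xs)
linIndep-tail {xs = xs} indep c relation i = indep (0ℚ Vector.∷ c) relation′ (suc i)
  where
  relation′ : ∀ v → 0ℚ * xs zero v + sumℚ (λ i → c i * xs (suc i) v) ≡ 0ℚ
  relation′ v = trans (cong (_+ sumℚ (λ i → c i * xs (suc i) v)) (*-zeroˡ (xs zero v)))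
                      (trans (+-identityˡ _) (relation v))

independentIn-map : ∀ {n k} {P Q : (Fin n → ℚ) → Set} → (∀ {x} → P x → Q x) →
                    IndependentIn P k → IndependentIn Q k
independentIn-map P⇒Q (xs , Pxs , indep) = xs , (λ i → P⇒Q (Pxs i)) , indep

independentIn-≤′ : ∀ {n k m} {P : (Fin n → ℚ) → Set} → k ≤′ m → IndependentIn P m → IndependentIn P k
independentIn-≤′         ≤′-refl        family              = family
independentIn-≤′ {P = P} (≤′-step k≤′m) (xs , Pxs , indep) =
  independentIn-≤′ {P = P} k≤′m (tail xs , Pxs ∘ suc , linIndep-tail {xs = xs} indep)

independentIn-≤ : ∀ {n k m} {P : (Fin n → ℚ) → Set} → k ≤ m → IndependentIn P m → IndependentIn P k
independentIn-≤ {P = P} k≤m = independentIn-≤′ {P = P} (≤⇒≤′ k≤m)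

VanishingAt : ∀ {n} → ((Fin n → ℚ) → Set) → Fin n → (Fin n → ℚ) → Set
VanishingAt P p y = P y × y p ≡ 0ℚ

independentIn-∷ : ∀ {n k} {P : (Fin n → ℚ) → Set} {z p} → P z → z p ≢ 0ℚ →
                  IndependentIn (VanishingAt P p) k → IndependentIn P (suc k)
independentIn-∷ {P = P} {z} {p} Pz zp≢0 (ys , Pys , indep) = z Vector.∷ ys , P-all , indep′
  where
  P-all : ∀ i → P ((z Vector.∷ ys) i)
  P-all zero    = Pz
  P-all (suc i) = proj₁ (Pys i)
  indep′ : LinIndep (z Vector.∷ ys)
  indep′ c relation = coefficients
    where
    open ≡-Reasoning
    rest : Fin _ → ℚ
    rest v = sumℚ (λ i → c (suc i) * ys i v)
    rest-p : rest p ≡ 0ℚ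
    rest-p = ∑-zero (λ i → trans (cong (c (suc i) *_) (proj₂ (Pys i))) (*-zeroʳ (c (suc i))))
    head≡0 : c zero ≡ 0ℚ
    head≡0 = p*q≡0⇒p≡0 zp≢0 (begin
      c zero * z p          ≡⟨ sym (+-identityʳ _) ⟩
      c zero * z p + 0ℚ     ≡⟨ cong (c zero * z p +_) (sym rest-p) ⟩
      c zero * z p + rest p ≡⟨ relation p ⟩
      0ℚ                    ∎)
    rest≡0 : ∀ v → rest v ≡ 0ℚ
    rest≡0 v = begin
      rest v                ≡⟨ sym (+-identityˡ (rest v)) ⟩
      0ℚ + rest v           ≡⟨ cong (_+ rest v) (sym (trans (cong (_* z v) head≡0) (*-zeroˡ (z v)))) ⟩
      c zero * z v + rest v ≡⟨ relation v ⟩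
      0ℚ                    ∎
    coefficients : ∀ i → c i ≡ 0ℚ
    coefficients zero    = head≡0
    coefficients (suc i) = indep (c ∘ suc) rest≡0 i

module Pivot {n m} (F : Fin (suc m) → Fin n → ℚ) (i : Fin (suc m)) (p : Fin n) where

  private
    π : ℚ
    π = F i p
    A : Fin m → Fin n → ℚ
    A = removeAt F i

  pivotOut : Fin m → Fin n → ℚ
  pivotOut j w = π * A j w - A j p * F i w

  pivotOut-vanishes : ∀ j → pivotOut j p ≡ 0ℚ
  pivotOut-vanishes j = solve 2 (λ a b → a :* b :- b :* a := con 0ℚ) refl π (A j p)

  -- A relation ∑ c j · pivotOut j = 0 lifts to the relation among the F k with
  -- coefficient c j · π at punchIn i j and −∑ c j · A j p at i.
  linIndep-pivotOut : π ≢ 0ℚ → LinIndep F → LinIndep pivotOut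
  linIndep-pivotOut π≢0 indep c relation j =
    p*q≡0⇒p≡0 π≢0 (trans (sym (insertAt-punchIn d′ i (- S) j)) (indep d lifted (punchIn i j)))
    where
    S : ℚ
    S = sumℚ (λ j → c j * A j p)
    d′ : Fin m → ℚ
    d′ j = c j * π
    d : Fin (suc m) → ℚ
    d = insertAt d′ i (- S)
    lifted : ∀ w → sumℚ (λ k → d k * F k w) ≡ 0ℚ
    lifted w = begin
      sumℚ (λ k → d k * F k w)
        ≡⟨ ∑-remove i (λ k → d k * F k w) ⟩
      d i * F i w + sumℚ (λ j → d (punchIn i j) * A j w)
        ≡⟨ cong₂ _+_ (cong (_* F i w) (insertAt-lookup d′ i (- S)))
                     (∑-cong (λ j → cong (_* A j w) (insertAt-punchIn d′ i (- S) j))) ⟩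
      - S * F i w + X
        ≡⟨ solve 3 (λ S f X → :- S :* f :+ X := X :- S :* f) refl S (F i w) X ⟩
      X - S * F i w
        ≡⟨ sym expand ⟩
      sumℚ (λ j → c j * pivotOut j w)
        ≡⟨ relation w ⟩
      0ℚ ∎
      where
      open ≡-Reasoning
      X : ℚ
      X = sumℚ (λ j → c j * π * A j w)
      expand : sumℚ (λ j → c j * pivotOut j w) ≡ X - S * F i w
      expand = begin
        sumℚ (λ j → c j * pivotOut j w)
          ≡⟨ ∑-cong (λ j → solve 5 (λ c π a b f → c :* (π :* a :- b :* f) := c :* π :* a :- c :* b :* f)
                                   refl (c j) π (A j w) (A j p) (F i w)) ⟩
        sumℚ (λ j → c j * π * A j w - c j * A j p * F i w)
          ≡⟨ ∑-sub (λ j → c j * π * A j w) (λ j → c j * A j p * F i w) ⟩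
        X - sumℚ (λ j → c j * A j p * F i w)
          ≡⟨ cong (λ s → X - s) (∑-*ʳ (λ j → c j * A j p) (F i w)) ⟩
        X - S * F i w ∎

independentIn-eliminate : ∀ {n m} {P : (Fin n → ℚ) → Set} → ClosedUnderCombinations P → ∀ p →
                          IndependentIn P (suc m) → IndependentIn (VanishingAt P p) m
independentIn-eliminate {P = P} closed p (F , PF , indep) with all? (λ i → F i p ≟ℚ 0ℚ)
... | yes F·p≡0 = tail F , (λ i → PF (suc i) , F·p≡0 (suc i)) , linIndep-tail {xs = F} indep
... | no ¬F·p≡0 with ¬∀⟶∃¬ _ _ (λ i → F i p ≟ℚ 0ℚ) ¬F·p≡0
...   | i , Fip≢0 = pivotOut , P-pivotOut , linIndep-pivotOut Fip≢0 indep
  where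
  open Pivot F i p
  P-pivotOut : ∀ j → VanishingAt P p (pivotOut j)
  P-pivotOut j = closed (F i p) (F (punchIn i j) p) (PF (punchIn i j)) (PF i) , pivotOut-vanishes j

dimension-suc : ∀ {n a b} {P Q : (Fin n → ℚ) → Set} →
  (∀ {k} → IndependentIn Q k → IndependentIn P (suc k)) →
  (∀ {k} → IndependentIn P (suc k) → IndependentIn Q k) →
  HasDimension P a → HasDimension Q b → a ≡ suc b
dimension-suc {P = P} {Q} enlarge shrink (indP , maxP) (indQ , maxQ) = ≤-antisym a≤1+b 1+b≤a
  where
  refute : ∀ {R : (Fin _ → ℚ) → Set} {m} → (∀ xs → (∀ i → R (xs i)) → ¬ LinIndep xs) → ¬ IndependentIn R (suc m)
  refute max (xs , Rxs , indep) = max xs Rxs indep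
  a≤1+b = ≮⇒≥ λ 1+b<a → refute {R = Q} maxQ (shrink (independentIn-≤ {P = P} 1+b<a indP))
  1+b≤a = ≮⇒≥ λ a<1+b → refute {R = P} maxP (independentIn-≤ {P = P} a<1+b (enlarge indQ))

minus-∈ : ∀ {n} {ps : List (Fin n)} {w} → w ∈ ps → minus ps w ≡ false
minus-∈ {w = w} (here refl) rewrite dec-true (w ≟ w) refl = refl
minus-∈ {ps = p ∷ _} {w} (there w∈ps) with does (w ≟ p)
... | true  = refl
... | false = minus-∈ w∈ps

minus-∉ : ∀ {n} {ps : List (Fin n)} {w} → w ∉ ps → minus ps w ≡ true
minus-∉ {ps = []}         _   = refl
minus-∉ {ps = p ∷ _}  {w} w∉ rewrite dec-false (w ≟ p) (w∉ ∘ here) = minus-∉ (w∉ ∘ there)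

minus≡false⇒∈ : ∀ {n} {ps : List (Fin n)} {w} → minus ps w ≡ false → w ∈ ps
minus≡false⇒∈ {ps = p ∷ _} {w} w∉ with w ≟ p
... | yes w≡p = here w≡p
... | no _    = there (minus≡false⇒∈ w∉)

module Configuration {n} {T : Graph n} {u₁ u₂ u₃ u₄ u₅ u₆ u₇ u₈ : Fin n}
  (distinct : Unique (u₁ ∷ u₂ ∷ u₃ ∷ u₄ ∷ u₅ ∷ u₆ ∷ u₇ ∷ u₈ ∷ []))
  (d₁ : deg T u₁ ≡ 1) (a₁₂ : Adj T u₁ u₂) (d₂ : deg T u₂ ≡ 2) (a₂₃ : Adj T u₂ u₃)
  (d₃ : deg T u₃ ≡ 3) (a₃₄ : Adj T u₃ u₄) (a₃₅ : Adj T u₃ u₅) (d₄ : deg T u₄ ≡ 1)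
  (d₅ : deg T u₅ ≡ 2) (d₆ : deg T u₆ ≡ 2) (a₅₆ : Adj T u₅ u₆) (a₆₈ : Adj T u₆ u₈)
  (d₇ : deg T u₇ ≡ 1) (a₇₈ : Adj T u₇ u₈) where

  private
    us : List (Fin n)
    us = u₁ ∷ u₂ ∷ u₃ ∷ u₄ ∷ u₅ ∷ u₆ ∷ u₇ ∷ u₈ ∷ []

  -- Indices are 0-based: u≢ 4F 0F : u₅ ≢ u₁.
  u≢ : ∀ i j {_ : False (i ≟ j)} → lookup us i ≢ lookup us j
  u≢ i j {i≢j} e = toWitnessFalse i≢j (lookup-injective distinct e)

  N₁ : Neighbourhood T allV u₁ (u₂ ∷ [])
  N₁ = neighbourhood-from-degree ([] ∷ []) (a₁₂ ∷ []) d₁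
  N₂ : Neighbourhood T allV u₂ (u₁ ∷ u₃ ∷ [])
  N₂ = neighbourhood-from-degree ((u≢ 0F 2F ∷ []) ∷ [] ∷ []) (Adj-sym T a₁₂ ∷ a₂₃ ∷ []) d₂
  N₃ : Neighbourhood T allV u₃ (u₄ ∷ u₂ ∷ u₅ ∷ [])
  N₃ = neighbourhood-from-degree ((u≢ 3F 1F ∷ u≢ 3F 4F ∷ []) ∷ (u≢ 1F 4F ∷ []) ∷ [] ∷ [])
                                 (a₃₄ ∷ Adj-sym T a₂₃ ∷ a₃₅ ∷ []) d₃
  N₄ : Neighbourhood T allV u₄ (u₃ ∷ [])
  N₄ = neighbourhood-from-degree ([] ∷ []) (Adj-sym T a₃₄ ∷ []) d₄
  N₅ : Neighbourhood T allV u₅ (u₃ ∷ u₆ ∷ [])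
  N₅ = neighbourhood-from-degree ((u≢ 2F 5F ∷ []) ∷ [] ∷ []) (Adj-sym T a₃₅ ∷ a₅₆ ∷ []) d₅
  N₆ : Neighbourhood T allV u₆ (u₅ ∷ u₈ ∷ [])
  N₆ = neighbourhood-from-degree ((u≢ 4F 7F ∷ []) ∷ [] ∷ []) (Adj-sym T a₅₆ ∷ a₆₈ ∷ []) d₆
  N₇ : Neighbourhood T allV u₇ (u₈ ∷ [])
  N₇ = neighbourhood-from-degree ([] ∷ []) (a₇₈ ∷ []) d₇

  removed : List (Fin n)
  removed = u₁ ∷ u₂ ∷ u₃ ∷ u₄ ∷ []

  V₁ : VSet n
  V₁ = minus removed

  ∉V₁⇒∈ : ∀ {w} → V₁ w ≡ false → w ∈ removed
  ∉V₁⇒∈ = minus≡false⇒∈ {ps = removed}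

  V₁∌u₁ : V₁ u₁ ≡ false
  V₁∌u₁ = minus-∈ {ps = removed} (here refl)
  V₁∌u₂ : V₁ u₂ ≡ false
  V₁∌u₂ = minus-∈ {ps = removed} (there (here refl))
  V₁∌u₃ : V₁ u₃ ≡ false
  V₁∌u₃ = minus-∈ {ps = removed} (there (there (here refl)))
  V₁∌u₄ : V₁ u₄ ≡ false
  V₁∌u₄ = minus-∈ {ps = removed} (there (there (there (here refl))))
  V₁∋u₅ : V₁ u₅ ≡ true
  V₁∋u₅ = minus-∉ {ps = removed} (All¬⇒¬Any (u≢ 4F 0F ∷ u≢ 4F 1F ∷ u≢ 4F 2F ∷ u≢ 4F 3F ∷ []))
  V₁∋u₆ : V₁ u₆ ≡ true
  V₁∋u₆ = minus-∉ {ps = removed} (All¬⇒¬Any (u≢ 5F 0F ∷ u≢ 5F 1F ∷ u≢ 5F 2F ∷ u≢ 5F 3F ∷ []))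
  V₁∋u₇ : V₁ u₇ ≡ true
  V₁∋u₇ = minus-∉ {ps = removed} (All¬⇒¬Any (u≢ 6F 0F ∷ u≢ 6F 1F ∷ u≢ 6F 2F ∷ u≢ 6F 3F ∷ []))
  V₁∋u₈ : V₁ u₈ ≡ true
  V₁∋u₈ = minus-∉ {ps = removed} (All¬⇒¬Any (u≢ 7F 0F ∷ u≢ 7F 1F ∷ u≢ 7F 2F ∷ u≢ 7F 3F ∷ []))

  N₅′ : Neighbourhood T V₁ u₅ (u₆ ∷ [])
  N₅′ = neighbourhood-restrict (u₃ ∷ []) N₅ V₁∋u₅ (V₁∌u₃ ∷ []) (V₁∋u₆ ∷ [])
  N₆′ : Neighbourhood T V₁ u₆ (u₅ ∷ u₈ ∷ [])
  N₆′ = neighbourhood-restrict [] N₆ V₁∋u₆ [] (V₁∋u₅ ∷ V₁∋u₈ ∷ [])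
  N₇′ : Neighbourhood T V₁ u₇ (u₈ ∷ [])
  N₇′ = neighbourhood-restrict [] N₇ V₁∋u₇ [] (V₁∋u₈ ∷ [])

  InBranch : Fin n → Set
  InBranch v = V₁ v ≡ false ⊎ v ≡ u₅

  boundary : ∀ {w v} → V₁ w ≡ false → Adj T w v → InBranch v
  boundary {w} w∉V₁ wv with ∉V₁⇒∈ {w} w∉V₁
  ... | here refl                         = All.lookup {P = InBranch} (inj₁ V₁∌u₂ ∷ []) (∈-neighbourhood N₁ wv)
  ... | there (here refl)                 = All.lookup {P = InBranch} (inj₁ V₁∌u₁ ∷ inj₁ V₁∌u₃ ∷ [])
                                                       (∈-neighbourhood N₂ wv)
  ... | there (there (here refl))         = All.lookup {P = InBranch} (inj₁ V₁∌u₄ ∷ inj₁ V₁∌u₂ ∷ inj₂ refl ∷ [])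
                                                       (∈-neighbourhood N₃ wv)
  ... | there (there (there (here refl))) = All.lookup {P = InBranch} (inj₁ V₁∌u₃ ∷ []) (∈-neighbourhood N₄ wv)

  degIn-V₁ : ∀ {v} → V₁ v ≡ true → v ≢ u₅ → degIn T V₁ v ≡ deg T v
  degIn-V₁ v∈V₁ v≢u₅ = degIn≡deg T V₁ v∈V₁ λ w∉V₁ vw →
    [ (λ v∉V₁ → contradiction (trans (sym v∈V₁) v∉V₁) λ ()) , v≢u₅ ] (boundary w∉V₁ (Adj-sym T vw))

  vanishes-or-same-degree : ∀ {x : Fin n → ℚ} {v} → V₁ v ≡ true → x u₅ ≡ 0ℚ →
                            x v ≡ 0ℚ ⊎ degIn T V₁ v ≡ deg T v
  vanishes-or-same-degree {v = v} v∈V₁ x₅ with v ≟ u₅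
  ... | yes refl = inj₁ x₅
  ... | no v≢u₅  = inj₂ (degIn-V₁ v∈V₁ v≢u₅)

  restrict : ∀ {x} → InEigenspace1 T allV x → x u₅ ≡ 0ℚ → InEigenspace1 T V₁ x
  restrict {x} E x₅ = vanishing , λ v v∈V₁ →
    trans (applyLaplacianIn-agree T V₁ {x} {v} v∈V₁ vanishing (vanishes-or-same-degree {x} v∈V₁ x₅))
          (proj₂ E v refl)
    where
    x₂ : x u₂ ≡ 0ℚ
    x₂ = eigen-pendant E refl N₁
    x₃ : x u₃ ≡ 0ℚ
    x₃ = eigen-pendant E refl N₄
    x₁ : x u₁ ≡ 0ℚ
    x₁ = eigen-neighbour-zero E refl N₂ x₂ (x₃ ∷ [])
    x₄ : x u₄ ≡ 0ℚ
    x₄ = eigen-neighbour-zero E refl N₃ x₃ (x₂ ∷ x₅ ∷ [])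
    vanishing : ∀ v → V₁ v ≡ false → x v ≡ 0ℚ
    vanishing v v∉V₁ with ∉V₁⇒∈ {v} v∉V₁
    ... | here refl                         = x₁
    ... | there (here refl)                 = x₂
    ... | there (there (here refl))         = x₃
    ... | there (there (there (here refl))) = x₄

  extend : ∀ {y} → InEigenspace1 T V₁ y → InEigenspace1 T allV y
  extend {y} E = (λ _ ()) , row
    where
    vanishing : ∀ v → V₁ v ≡ false → y v ≡ 0ℚ
    vanishing = proj₁ E
    y₅ : y u₅ ≡ 0ℚ
    y₅ = eigen-neighbour-zero E V₁∋u₆ N₆′ (eigen-pendant E V₁∋u₅ N₅′) (eigen-pendant E V₁∋u₇ N₇′ ∷ [])
    row : ∀ v → allV v ≡ true → applyLaplacianIn T allV y v ≡ y v
    row v _ with V₁ v in V₁v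
    ... | true  = trans (sym (applyLaplacianIn-agree T V₁ {y} {v} V₁v vanishing
                                                     (vanishes-or-same-degree {y} V₁v y₅)))
                        (proj₂ E v V₁v)
    ... | false = trans (applyLaplacianIn-null T allV refl yv≡0 (neighbourSumIn-null T nbr≡0)) (sym yv≡0)
      where
      yv≡0 : y v ≡ 0ℚ
      yv≡0 = vanishing v V₁v
      nbr≡0 : ∀ {w} → Adj T v w → y w ≡ 0ℚ
      nbr≡0 {w} vw = [ vanishing w , (λ { refl → y₅ }) ]′ (boundary V₁v vw)

  support : List (Fin n)
  support = u₄ ∷ u₅ ∷ u₆ ∷ u₇ ∷ []

  support-unique : Unique support
  support-unique =
    (u≢ 3F 4F ∷ u≢ 3F 5F ∷ u≢ 3F 6F ∷ []) ∷ (u≢ 4F 5F ∷ u≢ 4F 6F ∷ []) ∷ (u≢ 5F 6F ∷ []) ∷ [] ∷ []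

  z : Fin n → ℚ
  z w = if does (w ≟ u₄) then - 1ℚ else
        if does (w ≟ u₅) then 1ℚ else
        if does (w ≟ u₆) then 1ℚ else
        if does (w ≟ u₇) then - 1ℚ else 0ℚ

  z₄ : z u₄ ≡ - 1ℚ
  z₄ rewrite dec-true (u₄ ≟ u₄) refl = refl
  z₅ : z u₅ ≡ 1ℚ
  z₅ rewrite dec-false (u₅ ≟ u₄) (u≢ 4F 3F) | dec-true (u₅ ≟ u₅) refl = refl
  z₆ : z u₆ ≡ 1ℚ
  z₆ rewrite dec-false (u₆ ≟ u₄) (u≢ 5F 3F) | dec-false (u₆ ≟ u₅) (u≢ 5F 4F) | dec-true (u₆ ≟ u₆) refl = refl
  z₇ : z u₇ ≡ - 1ℚ
  z₇ rewrite dec-false (u₇ ≟ u₄) (u≢ 6F 3F) | dec-false (u₇ ≟ u₅) (u≢ 6F 4F) | dec-false (u₇ ≟ u₆) (u≢ 6F 5F)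
           | dec-true (u₇ ≟ u₇) refl = refl

  z-off : ∀ {w} → w ∉ support → z w ≡ 0ℚ
  z-off {w} w∉ rewrite dec-false (w ≟ u₄) (w∉ ∘ here) | dec-false (w ≟ u₅) (w∉ ∘ there ∘ here)
                     | dec-false (w ≟ u₆) (w∉ ∘ there ∘ there ∘ here)
                     | dec-false (w ≟ u₇) (w∉ ∘ there ∘ there ∘ there ∘ here) = refl

  z₃ : z u₃ ≡ 0ℚ
  z₃ = z-off (All¬⇒¬Any (u≢ 2F 3F ∷ u≢ 2F 4F ∷ u≢ 2F 5F ∷ u≢ 2F 6F ∷ []))
  z₈ : z u₈ ≡ 0ℚ
  z₈ = z-off (All¬⇒¬Any (u≢ 7F 3F ∷ u≢ 7F 4F ∷ u≢ 7F 5F ∷ u≢ 7F 6F ∷ []))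

  adj-u₄≡adj-u₅ : ∀ {v} → v ≢ u₆ → adj T v u₄ ≡ adj T v u₅
  adj-u₄≡adj-u₅ {v} v≢u₆ with v ≟ u₃
  ... | yes refl = trans a₃₄ (sym a₃₅)
  ... | no v≢u₃  = trans (non-neighbour N₄ (All¬⇒¬Any (v≢u₃ ∷ [])))
                         (sym (non-neighbour N₅ (All¬⇒¬Any (v≢u₃ ∷ v≢u₆ ∷ []))))

  adj-u₇≡adj-u₆ : ∀ {v} → v ≢ u₅ → adj T v u₇ ≡ adj T v u₆
  adj-u₇≡adj-u₆ {v} v≢u₅ with v ≟ u₈
  ... | yes refl = trans (Adj-sym T a₇₈) (sym (Adj-sym T a₆₈))
  ... | no v≢u₈  = trans (non-neighbour N₇ (All¬⇒¬Any (v≢u₈ ∷ [])))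
                         (sym (non-neighbour N₆ (All¬⇒¬Any (v≢u₅ ∷ v≢u₈ ∷ []))))

  neighbourSumIn-z : ∀ {v} → v ∉ support → neighbourSumIn T allV z v ≡ 0ℚ
  neighbourSumIn-z {v} v∉ = trans (∑-support support-unique off) cancel
    where
    off : ∀ {w} → w ∉ support → (if adj T v w then z w else 0ℚ) ≡ 0ℚ
    off {w} w∉ rewrite z-off w∉ with adj T v w
    ... | true  = refl
    ... | false = refl
    cancel : sumOver support (λ w → if adj T v w then z w else 0ℚ) ≡ 0ℚ
    cancel rewrite z₄ | z₅ | z₆ | z₇ | adj-u₄≡adj-u₅ (v∉ ∘ there ∘ there ∘ here)
                 | adj-u₇≡adj-u₆ (v∉ ∘ there ∘ here) with adj T v u₅ | adj T v u₆
    ... | true  | true  = refl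
    ... | true  | false = refl
    ... | false | true  = refl
    ... | false | false = refl

  z-eigen : InEigenspace1 T allV z
  z-eigen = (λ _ ()) , row
    where
    by-neighbourhood : ∀ {v ps} → Neighbourhood T allV v ps →
                       fromℕ (length ps) * z v - sumOver ps z ≡ z v → applyLaplacianIn T allV z v ≡ z v
    by-neighbourhood N eq = trans (applyLaplacianIn-neighbourhood N refl z) eq
    row₄ : fromℕ 1 * z u₄ - (z u₃ + 0ℚ) ≡ z u₄
    row₄ rewrite z₄ | z₃ = refl
    row₅ : fromℕ 2 * z u₅ - (z u₃ + (z u₆ + 0ℚ)) ≡ z u₅
    row₅ rewrite z₅ | z₃ | z₆ = refl
    row₆ : fromℕ 2 * z u₆ - (z u₅ + (z u₈ + 0ℚ)) ≡ z u₆
    row₆ rewrite z₆ | z₅ | z₈ = refl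
    row₇ : fromℕ 1 * z u₇ - (z u₈ + 0ℚ) ≡ z u₇
    row₇ rewrite z₇ | z₈ = refl
    row : ∀ v → allV v ≡ true → applyLaplacianIn T allV z v ≡ z v
    row v _ with Any.any? (v ≟_) support
    ... | yes (here refl)                         = by-neighbourhood N₄ row₄
    ... | yes (there (here refl))                 = by-neighbourhood N₅ row₅
    ... | yes (there (there (here refl)))         = by-neighbourhood N₆ row₆
    ... | yes (there (there (there (here refl)))) = by-neighbourhood N₇ row₇
    ... | no v∉support = trans (applyLaplacianIn-null T allV refl (z-off v∉support) (neighbourSumIn-z v∉support))
                               (sym (z-off v∉support))

  z₄≢0 : z u₄ ≢ 0ℚ
  z₄≢0 z₄≡0 with trans (sym z₄) z₄≡0
  ... | ()

  enlarge : ∀ {k} → IndependentIn (InEigenspace1 T V₁) k → IndependentIn (InEigenspace1 T allV) (suc k)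
  enlarge family = independentIn-∷ {P = InEigenspace1 T allV} z-eigen z₄≢0
                    (independentIn-map (λ {y} E → extend {y} E , proj₁ E u₄ V₁∌u₄) family)

  shrink : ∀ {k} → IndependentIn (InEigenspace1 T allV) (suc k) → IndependentIn (InEigenspace1 T V₁) k
  shrink family = independentIn-map {P = VanishingAt (InEigenspace1 T allV) u₅} {Q = InEigenspace1 T V₁}
                   (λ {x} (E , x₅) → restrict {x} E x₅)
                   (independentIn-eliminate {P = InEigenspace1 T allV} (inEigenspace1-closed T allV) u₅ family)

lemma2p9 : (n : ℕ) (T : Graph n) → IsTree T →
    (u₁ u₂ u₃ u₄ u₅ u₆ u₇ u₈ : Fin n) →
    Unique (u₁ ∷ u₂ ∷ u₃ ∷ u₄ ∷ u₅ ∷ u₆ ∷ u₇ ∷ u₈ ∷ []) →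
    deg T u₁ ≡ 1 → Adj T u₁ u₂ →
    deg T u₂ ≡ 2 → Adj T u₂ u₃ →
    deg T u₃ ≡ 3 → Adj T u₃ u₄ → Adj T u₃ u₅ → deg T u₄ ≡ 1 →
    deg T u₅ ≡ 2 → deg T u₆ ≡ 2 → Adj T u₅ u₆ → Adj T u₆ u₈ →
    deg T u₇ ≡ 1 → Adj T u₇ u₈ →
    ConnectedIn T (minus (u₁ ∷ u₂ ∷ u₃ ∷ u₄ ∷ u₅ ∷ u₆ ∷ u₇ ∷ [])) →
    (a b : ℕ) →
    MultLaplacian1 T allV a →
    MultLaplacian1 T (minus (u₁ ∷ u₂ ∷ u₃ ∷ u₄ ∷ [])) b →
    a ≡ suc b
lemma2p9 n T _ u₁ u₂ u₃ u₄ u₅ u₆ u₇ u₈ distinct d₁ a₁₂ d₂ a₂₃ d₃ a₃₄ a₃₅ d₄ d₅ d₆ a₅₆ a₆₈ d₇ a₇₈ _ a b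
         mult mult₁ =
  dimension-suc {P = InEigenspace1 T allV} {Q = InEigenspace1 T V₁} enlarge shrink mult mult₁
  where open Configuration {T = T} distinct d₁ a₁₂ d₂ a₂₃ d₃ a₃₄ a₃₅ d₄ d₅ d₆ a₅₆ a₆₈ d₇ a₇₈
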